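{- Let $N\ge 3$ and let $W_{N+1}$ be the wheel graph with vertices $v_0,\dots,v_N$, where $v_0,\dots,v_{N-1}$ form a cycle (edges $v_iv_{i+1}$, indices mod $N$) and the central vertex $v_N$ is adjacent to every $v_i$, $0\le i\le N-1$. Regard $W_{N+1}$ as an electrical network with every edge a unit resistor, and let $r(W_{N+1};N,0)$ be the effective resistance between $v_N$ and $v_0$. Then \[ r(W_{N+1};N,0)=\begin{cases}\dfrac{F_N}{F_{N-1}+F_{N+1}} & \text{if } N \text{ is odd},\\[2mm] \dfrac{L_N}{L_{N-1}+L_{N+1}} & \text{if } N \text{ is even}.\end{cases} \]
   Context: $F_n$ denotes the Fibonacci numbers ($F_0=0$, $F_1=1$, $F_{n+2}=F_{n+1}+F_n$) and $L_n$ the Lucas numbers ($L_0=2$, $L_1=1$, $L_{n+2}=L_{n+1}+L_n$). -}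

module Defs where

open import Data.Bool using (Bool; true; false; _∧_; _∨_; if_then_else_)
open import Data.Nat as ℕ using (ℕ; zero; suc; _+_; _∸_; _≡ᵇ_; _<ᵇ_; _<_; z<s; s<s; NonZero)
open import Data.Nat.Properties using (m≤n+m; <-≤-trans; +-mono-<)
open import Data.Integer using (+_)
open import Data.Fin using (Fin; toℕ; fromℕ) renaming (zero to fz; suc to fs)
open import Data.Rational using (ℚ; 0ℚ; 1ℚ; -_; _/_) renaming (_+_ to _+ℚ_; _-_ to _-ℚ_)

F : ℕ → ℕ
F 0 = 0
F 1 = 1
F (suc (suc n)) = F (suc n) + F n

L : ℕ → ℕ
L 0 = 2
L 1 = 1
L (suc (suc n)) = L (suc n) + L n

-- Wheel graph W_{N+1} on vertex set Fin (suc N): vertex i (toℕ i = i) is v_i.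
-- v_0..v_{N-1} form a cycle, v_N is the hub adjacent to all v_i, i < N.
cycleAdj : ℕ → ℕ → ℕ → Bool
cycleAdj N a b = (b ≡ᵇ suc a) ∨ (a ≡ᵇ suc b)
               ∨ ((a ≡ᵇ 0) ∧ (b ≡ᵇ N ∸ 1)) ∨ ((b ≡ᵇ 0) ∧ (a ≡ᵇ N ∸ 1))

wheelAdj : (N : ℕ) → Fin (suc N) → Fin (suc N) → Bool
wheelAdj N u w =
  ((a ≡ᵇ N) ∧ (b <ᵇ N)) ∨ ((b ≡ᵇ N) ∧ (a <ᵇ N))
  ∨ ((a <ᵇ N) ∧ (b <ᵇ N) ∧ cycleAdj N a b)
  where
  a = toℕ u
  b = toℕ w

sumFin : (n : ℕ) → (Fin n → ℚ) → ℚ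
sumFin zero f = 0ℚ
sumFin (suc n) f = f fz +ℚ sumFin n (λ i → f (fs i))

outCurrent : (N : ℕ) → (Fin (suc N) → ℚ) → Fin (suc N) → ℚ
outCurrent N φ u = sumFin (suc N) (λ w → if wheelAdj N u w then φ u -ℚ φ w else 0ℚ)

hub : (N : ℕ) → Fin (suc N)
hub N = fromℕ N

injection : (N : ℕ) → Fin (suc N) → ℚ
injection N u = if toℕ u ≡ᵇ N then 1ℚ else (if toℕ u ≡ᵇ 0 then - 1ℚ else 0ℚ)

IsUnitFlowPotential : (N : ℕ) → (Fin (suc N) → ℚ) → Set
IsUnitFlowPotential N φ = ∀ u → outCurrent N φ u ≡ injection N u
  where open import Relation.Binary.PropositionalEquality using (_≡_)

F-suc-pos : ∀ n → 0 < F (suc n)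
F-suc-pos zero = z<s
F-suc-pos (suc n) = <-≤-trans (F-suc-pos n) (Data.Nat.Properties.m≤m+n (F (suc n)) (F n))
  where import Data.Nat.Properties

L-suc-pos : ∀ n → 0 < L (suc n)
L-suc-pos zero = z<s
L-suc-pos (suc n) = <-≤-trans (L-suc-pos n) (Data.Nat.Properties.m≤m+n (L (suc n)) (L n))
  where import Data.Nat.Properties

F-den-nz : ∀ N → NonZero (F (N ∸ 1) + F (suc N))
F-den-nz N = ℕ.>-nonZero (<-≤-trans (F-suc-pos N) (m≤n+m (F (suc N)) (F (N ∸ 1))))

L-den-nz : ∀ N → NonZero (L (N ∸ 1) + L (suc N))
L-den-nz N = ℕ.>-nonZero (<-≤-trans (L-suc-pos N) (m≤n+m (L (suc N)) (L (N ∸ 1))))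

wheelResistance : ℕ → ℚ
wheelResistance N =
  if N ℕ.% 2 ≡ᵇ 1
  then _/_ (+ F N) (F (N ∸ 1) + F (suc N)) {{F-den-nz N}}
  else _/_ (+ L N) (L (N ∸ 1) + L (suc N)) {{L-den-nz N}}

{-# OPTIONS --safe #-}

-- Ground the hub and let x k be the potential of the rim vertex v_k (indices mod N).
-- Kirchhoff's law at v_k, k ≠ 0, reads x (k - 1) + x (k + 1) = 3 x k, the recurrence of
-- every other Fibonacci number, and at v_0 it reads 3 x 0 - x 1 - x (N - 1) = -1.
-- The folded sequence Y k = G ∣N - 2k∣, with G = F for odd N and G = L for even N, obeys
-- the recurrence all around the rim (because G (- j) = G j for j ≡ N mod 2) and Y N = Y 0,
-- so x = - Y / D with D = 3 Y 0 - Y 1 - Y (N - 1) = G (N - 1) + G (N + 1) is a solution.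
-- Conversely, for every solution x the Wronskian Y k x (k + 1) - x k Y (k + 1) takes the
-- same value at k = 0 and k = N - 1, which together with the law at v_0 forces
-- x 0 = - Y 0 / D. The resistance is - x 0 = G N / D.

module Submission where

open import Defs
open import Data.Nat using (ℕ; _≤_)
open import Data.Fin using (Fin; zero; fromℕ)
open import Data.Product using (Σ; _×_)
open import Data.Rational using (ℚ; _-_)
open import Relation.Binary.PropositionalEquality using (_≡_)

open import Algebra.Bundles using (CommutativeRing)
open import Data.Bool using (true; false; T; _∧_; _∨_; if_then_else_)
open import Data.Bool.Properties using (T-∨; T-∧)
open import Data.Empty using (⊥-elim)
open import Data.Fin using (suc; toℕ; inject₁; _≟_)
import Data.Fin.Properties as Finₚ
open import Data.Integer as ℤ using (1ℤ)
import Data.Integer.Properties as ℤₚ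
import Data.Integer.Tactic.RingSolver as ℤ-Solver
open import Data.List using (_∷_; [])
open import Data.Nat as ℕ using (zero; suc; _<_; z<s; s<s; s≤s; z≤n; _∸_; _%_; _≡ᵇ_; _<ᵇ_; ∣_-_∣; NonZero)
open import Data.Nat.DivMod using (_mod_; m<n⇒m%n≡m; n%n≡0)
import Data.Nat.Properties as ℕₚ
import Data.Nat.Tactic.RingSolver as ℕ-Solver
open import Data.Product using (_,_; ∃-syntax)
open import Data.Rational using (0ℚ; 1ℚ; _+_; _*_; -_; _/_; 1/_)
open import Data.Rational.Literals using (fromℤ)
import Data.Rational.Properties as ℚₚ
open import Data.Rational.Unnormalised as ℚᵘ using (*≡*)
import Data.Rational.Unnormalised.Properties as ℚᵘₚ
open import Data.Sum using (_⊎_; inj₁; inj₂)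
open import Function using (_∘_; _⇔_; Equivalence; mk⇔)
open import Level using (0ℓ)
open import Relation.Binary.PropositionalEquality
  using (_≢_; refl; sym; trans; cong; cong₂; subst; subst₂; module ≡-Reasoning)
open import Relation.Nullary using (¬_; yes; no; does)
open import Relation.Nullary.Decidable using (dec-true; dec-false; dec⇒maybe)
open import Tactic.RingSolver using (solve)
import Tactic.RingSolver.Core.AlmostCommutativeRing as ACR

open import Algebra.Properties.Semiring.Sum (CommutativeRing.semiring ℚₚ.+-*-commutativeRing)
  using (sum; sum-syntax; ∑-distrib-+; sum-cong-≗; sum-replicate-zero; sum-init-last; *-distribˡ-sum)

open import Algebra.Properties.Group ℚₚ.+-0-group
  using () renaming (⁻¹-involutive to neg-involutive; ⁻¹-anti-homo-// to neg-sub)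

open ≡-Reasoning

ℚ-ring : ACR.AlmostCommutativeRing 0ℓ 0ℓ
ℚ-ring = ACR.fromCommutativeRing ℚₚ.+-*-commutativeRing (λ x → dec⇒maybe (0ℚ ℚₚ.≟ x))

-- Unlike + n / 1, fromℤ does not normalise, so toℚᵘ (toℚ n) reduces to n / 1.
toℚ : ℕ → ℚ
toℚ n = fromℤ (ℤ.+ n)

toℚ-+ : ∀ m n → toℚ (m ℕ.+ n) ≡ toℚ m + toℚ n
toℚ-+ m n = ℚₚ.toℚᵘ-injective (ℚᵘₚ.≃-sym (ℚᵘₚ.≃-trans (ℚₚ.toℚᵘ-homo-+ (toℚ m) (toℚ n))
  (*≡* (trans (regroup (ℤ.+ m) (ℤ.+ n)) (cong (ℤ._* (1ℤ ℤ.* 1ℤ)) (sym (ℤₚ.pos-+ m n)))))))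
  where
  regroup : ∀ a b → (a ℤ.* 1ℤ ℤ.+ b ℤ.* 1ℤ) ℤ.* 1ℤ ≡ (a ℤ.+ b) ℤ.* (1ℤ ℤ.* 1ℤ)
  regroup = ℤ-Solver.solve-∀

toℚ-* : ∀ m n → toℚ (m ℕ.* n) ≡ toℚ m * toℚ n
toℚ-* m n = ℚₚ.toℚᵘ-injective (ℚᵘₚ.≃-sym (ℚᵘₚ.≃-trans (ℚₚ.toℚᵘ-homo-* (toℚ m) (toℚ n))
  (*≡* (trans (regroup (ℤ.+ m) (ℤ.+ n)) (cong (ℤ._* (1ℤ ℤ.* 1ℤ)) (sym (ℤₚ.pos-* m n)))))))
  where
  regroup : ∀ a b → (a ℤ.* b) ℤ.* 1ℤ ≡ (a ℤ.* b) ℤ.* (1ℤ ℤ.* 1ℤ)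
  regroup = ℤ-Solver.solve-∀

/-*-toℚ : ∀ n d .{{_ : NonZero d}} → (ℤ.+ n / d) * toℚ d ≡ toℚ n
/-*-toℚ n (suc k) = ℚₚ.toℚᵘ-injective (ℚᵘₚ.≃-trans (ℚₚ.toℚᵘ-homo-* (ℤ.+ n / suc k) (toℚ (suc k)))
  (ℚᵘₚ.≃-trans (ℚᵘₚ.*-congʳ (ℚₚ.toℚᵘ-fromℚᵘ (ℚᵘ.mkℚᵘ (ℤ.+ n) k))) (*≡* (regroup (ℤ.+ n) (ℤ.+ suc k)))))
  where
  regroup : ∀ a b → (a ℤ.* b) ℤ.* 1ℤ ≡ a ℤ.* (b ℤ.* 1ℤ)
  regroup = ℤ-Solver.solve-∀

*-toℚ-cancelʳ : ∀ {x y} d .{{_ : NonZero d}} → x * toℚ d ≡ y * toℚ d → x ≡ y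
*-toℚ-cancelʳ {x} {y} d eq = trans (undo x) (trans (cong (_* 1/ toℚ d) eq) (sym (undo y)))
  where
  undo : ∀ z → z ≡ (z * toℚ d) * 1/ toℚ d
  undo z = trans (sym (ℚₚ.*-identityʳ z))
    (trans (cong (z *_) (sym (ℚₚ.*-inverseʳ (toℚ d)))) (sym (ℚₚ.*-assoc z (toℚ d) (1/ toℚ d))))

*-toℚ⇒≡/ : ∀ {x} n d .{{_ : NonZero d}} → x * toℚ d ≡ toℚ n → x ≡ ℤ.+ n / d
*-toℚ⇒≡/ n d eq = *-toℚ-cancelʳ d (trans eq (sym (/-*-toℚ n d)))

p≡q⇒p-q≡0 : ∀ {p q} → p ≡ q → p - q ≡ 0ℚ
p≡q⇒p-q≡0 {q = q} refl = ℚₚ.+-inverseʳ q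

sumFin≡sum : ∀ n (f : Fin n → ℚ) → sumFin n f ≡ sum f
sumFin≡sum zero    f = refl
sumFin≡sum (suc n) f = cong (f zero +_) (sumFin≡sum n (f ∘ suc))

∑-neg : ∀ n (f : Fin n → ℚ) → ∑[ i < n ] (- f i) ≡ - sum f
∑-neg zero    f = refl
∑-neg (suc n) f = trans (cong (- f zero +_) (∑-neg n (f ∘ suc))) (sym (ℚₚ.neg-distrib-+ (f zero) (sum (f ∘ suc))))

sum-supported₁ : ∀ {n} (f : Fin n → ℚ) a → (∀ w → w ≢ a → f w ≡ 0ℚ) → sum f ≡ f a
sum-supported₁ {suc n} f zero vanish = begin
  f zero + sum (f ∘ suc)       ≡⟨ cong (f zero +_) (sum-cong-≗ (λ w → vanish (suc w) λ ())) ⟩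
  f zero + sum {n} (λ _ → 0ℚ)  ≡⟨ cong (f zero +_) (sum-replicate-zero n) ⟩
  f zero + 0ℚ                  ≡⟨ ℚₚ.+-identityʳ (f zero) ⟩
  f zero                       ∎
sum-supported₁ f (suc a) vanish = begin
  f zero + sum (f ∘ suc)  ≡⟨ cong₂ _+_ (vanish zero λ ()) (sum-supported₁ (f ∘ suc) a (λ w w≢a → vanish (suc w) (w≢a ∘ Finₚ.suc-injective))) ⟩
  0ℚ + f (suc a)          ≡⟨ ℚₚ.+-identityˡ (f (suc a)) ⟩
  f (suc a)               ∎

sum-supported₃ : ∀ {n} (f : Fin n → ℚ) {a b c} → a ≢ b → a ≢ c → b ≢ c →
                 (∀ w → w ≢ a → w ≢ b → w ≢ c → f w ≡ 0ℚ) → sum f ≡ f a + (f b + f c)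
sum-supported₃ f {a} {b} {c} a≢b a≢c b≢c vanish = begin
  sum f                                     ≡⟨ sum-cong-≗ split ⟩
  sum (λ w → at a w + (at b w + at c w))    ≡⟨ ∑-distrib-+ (at a) _ ⟩
  sum (at a) + sum (λ w → at b w + at c w)  ≡⟨ cong (sum (at a) +_) (∑-distrib-+ (at b) (at c)) ⟩
  sum (at a) + (sum (at b) + sum (at c))    ≡⟨ cong₂ _+_ (sum-at a) (cong₂ _+_ (sum-at b) (sum-at c)) ⟩
  f a + (f b + f c)                         ∎
  where
  at : Fin _ → Fin _ → ℚ
  at p w = if does (w ≟ p) then f p else 0ℚ
  sum-at : ∀ p → sum (at p) ≡ f p
  sum-at p = trans (sum-supported₁ (at p) p (λ w w≢p → cong (λ d → if d then f p else 0ℚ) (dec-false (w ≟ p) w≢p)))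
                   (cong (λ d → if d then f p else 0ℚ) (dec-true (p ≟ p) refl))
  split : ∀ w → f w ≡ at a w + (at b w + at c w)
  split w with w ≟ a | w ≟ b | w ≟ c
  ... | yes refl | yes a≡b  | _        = ⊥-elim (a≢b a≡b)
  ... | yes refl | no _     | yes a≡c  = ⊥-elim (a≢c a≡c)
  ... | no _     | yes refl | yes b≡c  = ⊥-elim (b≢c b≡c)
  ... | yes refl | no _     | no _     = sym (trans (cong (f w +_) (ℚₚ.+-identityʳ 0ℚ)) (ℚₚ.+-identityʳ (f w)))
  ... | no _     | yes refl | no _     = sym (trans (ℚₚ.+-identityˡ _) (ℚₚ.+-identityʳ (f w)))
  ... | no _     | no _     | yes refl = sym (trans (ℚₚ.+-identityˡ _) (ℚₚ.+-identityˡ (f w)))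
  ... | no w≢a   | no w≢b   | no w≢c   = trans (vanish w w≢a w≢b w≢c) (sym (trans (ℚₚ.+-identityˡ _) (ℚₚ.+-identityˡ 0ℚ)))

∑-telescope : ∀ n (Δ : ℕ → ℚ) → ∑[ i < n ] (Δ (suc (toℕ i)) - Δ (toℕ i)) ≡ Δ n - Δ 0
∑-telescope zero    Δ = sym (ℚₚ.+-inverseʳ (Δ 0))
∑-telescope (suc n) Δ = begin
  (Δ 1 - Δ 0) + ∑[ i < n ] (Δ (2 ℕ.+ toℕ i) - Δ (1 ℕ.+ toℕ i))  ≡⟨ cong ((Δ 1 - Δ 0) +_) (∑-telescope n (Δ ∘ suc)) ⟩
  (Δ 1 - Δ 0) + (Δ (suc n) - Δ 1)                                ≡⟨ chain (Δ 0) (Δ 1) (Δ (suc n)) ⟩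
  Δ (suc n) - Δ 0                                                ∎
  where
  chain : ∀ a b c → (b - a) + (c - b) ≡ c - a
  chain a b c = solve (a ∷ b ∷ c ∷ []) ℚ-ring

-- The recurrence x (j + 2) = 3 x (j + 1) - x j

ThreeTerm : (ℕ → ℚ) → ℕ → Set
ThreeTerm x j = toℚ 3 * x (suc j) - x j - x (suc (suc j)) ≡ 0ℚ

threeTerm-intro : ∀ x j → x j + x (suc (suc j)) ≡ toℚ 3 * x (suc j) → ThreeTerm x j
threeTerm-intro x j sum≡ = begin
  toℚ 3 * b - a - c       ≡⟨ regroup a b c ⟩
  toℚ 3 * b - (a + c)     ≡⟨ cong (λ t → toℚ 3 * b - t) sum≡ ⟩
  toℚ 3 * b - toℚ 3 * b   ≡⟨ ℚₚ.+-inverseʳ (toℚ 3 * b) ⟩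
  0ℚ                      ∎
  where
  a = x j; b = x (suc j); c = x (suc (suc j))
  regroup : ∀ a b c → toℚ 3 * b - a - c ≡ toℚ 3 * b - (a + c)
  regroup a b c = solve (a ∷ b ∷ c ∷ []) ℚ-ring

3a-b-c-scale : ∀ s a b c → toℚ 3 * (s * b) - s * a - s * c ≡ s * (toℚ 3 * b - a - c)
3a-b-c-scale s a b c = solve (s ∷ a ∷ b ∷ c ∷ []) ℚ-ring

threeTerm-scale : ∀ s {x} j → ThreeTerm x j → ThreeTerm (λ k → s * x k) j
threeTerm-scale s {x} j rec = begin
  toℚ 3 * (s * b) - s * a - s * c  ≡⟨ 3a-b-c-scale s a b c ⟩
  s * (toℚ 3 * b - a - c)          ≡⟨ cong (s *_) rec ⟩
  s * 0ℚ                           ≡⟨ ℚₚ.*-zeroʳ s ⟩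
  0ℚ                               ∎
  where
  a = x j; b = x (suc j); c = x (suc (suc j))

wronskian : (ℕ → ℚ) → (ℕ → ℚ) → ℕ → ℚ
wronskian y x j = y j * x (suc j) - x j * y (suc j)

wronskian-step : ∀ y x j → ThreeTerm y j → ThreeTerm x j → wronskian y x (suc j) ≡ wronskian y x j
wronskian-step y x j recʸ recˣ = begin
  b * r - q * c                                                                ≡⟨ expand a b c p q r ⟩
  (a * q - p * b) + (q * (toℚ 3 * b - a - c) - b * (toℚ 3 * q - p - r))       ≡⟨ cong₂ (λ s t → (a * q - p * b) + (q * s - b * t)) recʸ recˣ ⟩
  (a * q - p * b) + (q * 0ℚ - b * 0ℚ)                                          ≡⟨ drop (a * q - p * b) b q ⟩
  a * q - p * b                                                                ∎
  where
  a = y j; b = y (suc j); c = y (suc (suc j))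
  p = x j; q = x (suc j); r = x (suc (suc j))
  expand : ∀ a b c p q r → b * r - q * c ≡ (a * q - p * b) + (q * (toℚ 3 * b - a - c) - b * (toℚ 3 * q - p - r))
  expand a b c p q r = solve (a ∷ b ∷ c ∷ p ∷ q ∷ r ∷ []) ℚ-ring
  drop : ∀ w b q → w + (q * 0ℚ - b * 0ℚ) ≡ w
  drop w b q = solve (w ∷ b ∷ q ∷ []) ℚ-ring

wronskian-constant : ∀ y x n → (∀ j → j < n → ThreeTerm y j) → (∀ j → j < n → ThreeTerm x j) →
                     wronskian y x n ≡ wronskian y x 0
wronskian-constant y x zero    _    _    = refl
wronskian-constant y x (suc n) recʸ recˣ =
  trans (wronskian-step y x n (recʸ n (ℕₚ.n<1+n n)) (recˣ n (ℕₚ.n<1+n n)))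
        (wronskian-constant y x n (λ j → recʸ j ∘ ℕₚ.m<n⇒m<1+n) (λ j → recˣ j ∘ ℕₚ.m<n⇒m<1+n))

value-at-origin : ∀ m y x → (∀ j → j < m → ThreeTerm y j) → (∀ j → j < m → ThreeTerm x j) →
               y (suc m) ≡ y 0 → x (suc m) ≡ x 0 → toℚ 3 * x 0 - x 1 - x m ≡ - 1ℚ →
               x 0 * (toℚ 3 * y 0 - y 1 - y m) ≡ - y 0
value-at-origin m y x recʸ recˣ yₘ₊₁≡y₀ xₘ₊₁≡x₀ origin = begin
  x 0 * (toℚ 3 * y 0 - y 1 - y m)
    ≡⟨ expand (y 0) (y 1) (y m) (x 0) (x 1) (x m) ⟩
  - y 0 + (- (closing - opening) + y 0 * ((toℚ 3 * x 0 - x 1 - x m) - - 1ℚ))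
    ≡⟨ cong₂ (λ s t → - y 0 + (- s + y 0 * t)) (p≡q⇒p-q≡0 closing≡opening) (p≡q⇒p-q≡0 origin) ⟩
  - y 0 + (- 0ℚ + y 0 * 0ℚ)
    ≡⟨ drop (y 0) ⟩
  - y 0 ∎
  where
  closing = y m * x 0 - x m * y 0
  opening = wronskian y x 0
  closing≡opening : closing ≡ opening
  closing≡opening = begin
    y m * x 0 - x m * y 0  ≡⟨ cong₂ (λ s t → y m * s - x m * t) xₘ₊₁≡x₀ yₘ₊₁≡y₀ ⟨
    wronskian y x m        ≡⟨ wronskian-constant y x m recʸ recˣ ⟩
    opening                ∎
  expand : ∀ y₀ y₁ yₘ x₀ x₁ xₘ → x₀ * (toℚ 3 * y₀ - y₁ - yₘ)
         ≡ - y₀ + (- ((yₘ * x₀ - xₘ * y₀) - (y₀ * x₁ - x₀ * y₁)) + y₀ * ((toℚ 3 * x₀ - x₁ - xₘ) - - 1ℚ))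
  expand y₀ y₁ yₘ x₀ x₁ xₘ = solve (y₀ ∷ y₁ ∷ yₘ ∷ x₀ ∷ x₁ ∷ xₘ ∷ []) ℚ-ring
  drop : ∀ a → - a + (- 0ℚ + a * 0ℚ) ≡ - a
  drop a = solve (a ∷ []) ℚ-ring

∑-threeTerm : ∀ m y → (∀ j → j < m → ThreeTerm y j) → y (suc m) ≡ y 0 →
              ∑[ i < suc m ] y (toℕ i) ≡ toℚ 3 * y 0 - y 1 - y m
∑-threeTerm m y rec yₘ₊₁≡y₀ = begin
  y 0 + ∑[ i < m ] y (suc (toℕ i))                ≡⟨ cong (y 0 +_) (sum-cong-≗ (λ i → second-difference (rec (toℕ i) (Finₚ.toℕ<n i)))) ⟩
  y 0 + ∑[ i < m ] (Δ (suc (toℕ i)) - Δ (toℕ i))  ≡⟨ cong (y 0 +_) (∑-telescope m Δ) ⟩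
  y 0 + ((y (suc m) - y m) - (y 1 - y 0))         ≡⟨ cong (λ t → y 0 + ((t - y m) - (y 1 - y 0))) yₘ₊₁≡y₀ ⟩
  y 0 + ((y 0 - y m) - (y 1 - y 0))               ≡⟨ collect (y 0) (y 1) (y m) ⟩
  toℚ 3 * y 0 - y 1 - y m                         ∎
  where
  Δ : ℕ → ℚ
  Δ k = y (suc k) - y k
  second-difference : ∀ {k} → ThreeTerm y k → y (suc k) ≡ Δ (suc k) - Δ k
  second-difference {k} recₖ = sym (begin
    (c - b) - (b - a)              ≡⟨ regroup a b c ⟩
    b - (toℚ 3 * b - a - c)        ≡⟨ cong (λ t → b - t) recₖ ⟩
    b - 0ℚ                         ≡⟨ ℚₚ.+-identityʳ b ⟩
    b                              ∎)
    where
    a = y k; b = y (suc k); c = y (suc (suc k))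
    regroup : ∀ a b c → (c - b) - (b - a) ≡ b - (toℚ 3 * b - a - c)
    regroup a b c = solve (a ∷ b ∷ c ∷ []) ℚ-ring
  collect : ∀ a b c → a + ((a - c) - (b - a)) ≡ toℚ 3 * a - b - c
  collect a b c = solve (a ∷ b ∷ c ∷ []) ℚ-ring

FibLike : (ℕ → ℕ) → Set
FibLike G = ∀ n → G (suc (suc n)) ≡ G (suc n) ℕ.+ G n

-- G (- k) = G k for all k of the parity of n, where G (- k) continues the recurrence
-- backwards (G (- 1) = G 1 - G 0, G (- 2) = 2 G 0 - G 1).
Reflectable : (ℕ → ℕ) → ℕ → Set
Reflectable G zero          = G 0 ≡ 2 ℕ.* G 1
Reflectable G (suc zero)    = G 0 ≡ 0
Reflectable G (suc (suc n)) = Reflectable G n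

module _ {G : ℕ → ℕ} (fib : FibLike G) where

  bisection : ∀ n → G n ℕ.+ G (4 ℕ.+ n) ≡ 3 ℕ.* G (2 ℕ.+ n)
  bisection n rewrite fib (2 ℕ.+ n) | fib (1 ℕ.+ n) | fib n = regroup (G (1 ℕ.+ n)) (G n)
    where
    regroup : ∀ a b → b ℕ.+ (((a ℕ.+ b) ℕ.+ a) ℕ.+ (a ℕ.+ b)) ≡ 3 ℕ.* (a ℕ.+ b)
    regroup = ℕ-Solver.solve-∀

  odd-turn : G 0 ≡ 0 → G 1 ℕ.+ G 3 ≡ 3 ℕ.* G 1
  odd-turn G₀≡0 rewrite fib 1 | fib 0 | G₀≡0 = regroup (G 1)
    where
    regroup : ∀ a → a ℕ.+ ((a ℕ.+ 0) ℕ.+ a) ≡ 3 ℕ.* a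
    regroup = ℕ-Solver.solve-∀

  even-turn : G 0 ≡ 2 ℕ.* G 1 → G 2 ℕ.+ G 2 ≡ 3 ℕ.* G 0
  even-turn G₀≡2G₁ rewrite fib 0 | G₀≡2G₁ = regroup (G 1)
    where
    regroup : ∀ a → (a ℕ.+ 2 ℕ.* a) ℕ.+ (a ℕ.+ 2 ℕ.* a) ≡ 3 ℕ.* (2 ℕ.* a)
    regroup = ℕ-Solver.solve-∀

  folded-bisection : ∀ n i → Reflectable G n →
                     G ∣ n - i ℕ.* 2 ∣ ℕ.+ G ∣ n - (2 ℕ.+ i) ℕ.* 2 ∣ ≡ 3 ℕ.* G ∣ n - (1 ℕ.+ i) ℕ.* 2 ∣
  folded-bisection zero                i       _ = bisection (i ℕ.* 2)
  folded-bisection (suc zero)          zero    r = odd-turn r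
  folded-bisection (suc zero)          (suc i) _ = bisection (1 ℕ.+ i ℕ.* 2)
  folded-bisection (suc (suc zero))    zero    r = even-turn r
  folded-bisection (suc (suc (suc zero))) zero r = trans (ℕₚ.+-comm (G 3) (G 1)) (odd-turn r)
  folded-bisection (suc (suc (suc (suc n)))) zero _ =
    trans (cong (λ k → G (4 ℕ.+ n) ℕ.+ G k) (ℕₚ.∣-∣-identityʳ n))
          (trans (ℕₚ.+-comm (G (4 ℕ.+ n)) (G n)) (bisection n))
  folded-bisection (suc (suc n))       (suc i) r = folded-bisection n i r

-- The wheel graph

data CycleEdge (N : ℕ) : ℕ → ℕ → Set where
  forward  : ∀ {a} → CycleEdge N a (suc a)
  backward : ∀ {a} → CycleEdge N (suc a) a
  wrap     : CycleEdge N (N ∸ 1) 0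
  wrap⁻¹   : CycleEdge N 0 (N ∸ 1)

data WheelEdge (N : ℕ) : ℕ → ℕ → Set where
  spoke    : ∀ {a} → a < N → WheelEdge N a N
  spoke⁻¹  : ∀ {b} → b < N → WheelEdge N N b
  rim-edge : ∀ {a b} → a < N → b < N → CycleEdge N a b → WheelEdge N a b

private
  T-∨⁻ : ∀ x {y} → T (x ∨ y) → T x ⊎ T y
  T-∨⁻ x = Equivalence.to (T-∨ {x})

  T-∧⁻ : ∀ x {y} → T (x ∧ y) → T x × T y
  T-∧⁻ x = Equivalence.to (T-∧ {x})

  T-∨ˡ : ∀ {x} y → T x → T (x ∨ y)
  T-∨ˡ y p = Equivalence.from T-∨ (inj₁ p)

  T-∨ʳ : ∀ x {y} → T y → T (x ∨ y)
  T-∨ʳ x p = Equivalence.from (T-∨ {x}) (inj₂ p)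

  T-∧⁺ : ∀ {x y} → T x → T y → T (x ∧ y)
  T-∧⁺ p q = Equivalence.from T-∧ (p , q)

  T-≡ᵇ : ∀ n → T (n ≡ᵇ n)
  T-≡ᵇ n = ℕₚ.≡⇒≡ᵇ n n refl

  if-true : ∀ {A : Set} {b} {x y : A} → T b → (if b then x else y) ≡ x
  if-true {b = true} _ = refl

  if-false : ∀ {A : Set} {b} {x y : A} → ¬ T b → (if b then x else y) ≡ y
  if-false {b = true}  ¬t = ⊥-elim (¬t _)
  if-false {b = false} _  = refl

cycleAdj-sound : ∀ N a b → T (cycleAdj N a b) → CycleEdge N a b
cycleAdj-sound N a b t with T-∨⁻ (b ≡ᵇ suc a) t
... | inj₁ p rewrite ℕₚ.≡ᵇ⇒≡ b (suc a) p = forward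
... | inj₂ t with T-∨⁻ (a ≡ᵇ suc b) t
...   | inj₁ p rewrite ℕₚ.≡ᵇ⇒≡ a (suc b) p = backward
...   | inj₂ t with T-∨⁻ ((a ≡ᵇ 0) ∧ (b ≡ᵇ N ∸ 1)) t
...     | inj₁ p with T-∧⁻ (a ≡ᵇ 0) p
...       | a≡0 , b≡N-1 rewrite ℕₚ.≡ᵇ⇒≡ a 0 a≡0 | ℕₚ.≡ᵇ⇒≡ b (N ∸ 1) b≡N-1 = wrap⁻¹
cycleAdj-sound N a b t | inj₂ _ | inj₂ _ | inj₂ p with T-∧⁻ (b ≡ᵇ 0) p
... | b≡0 , a≡N-1 rewrite ℕₚ.≡ᵇ⇒≡ b 0 b≡0 | ℕₚ.≡ᵇ⇒≡ a (N ∸ 1) a≡N-1 = wrap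

cycleAdj-complete : ∀ {N a b} → CycleEdge N a b → T (cycleAdj N a b)
cycleAdj-complete {N} {a} forward  = T-∨ˡ _ (T-≡ᵇ a)
cycleAdj-complete {N} {_} {b} backward = T-∨ʳ (b ≡ᵇ suc (suc b)) (T-∨ˡ _ (T-≡ᵇ b))
cycleAdj-complete {N} wrap   = T-∨ʳ (N ∸ 1 ≡ᵇ 1) (T-∨ʳ ((N ∸ 1 ≡ᵇ 0) ∧ (0 ≡ᵇ N ∸ 1)) (T-≡ᵇ (N ∸ 1)))
cycleAdj-complete {N} wrap⁻¹ = T-∨ʳ (N ∸ 1 ≡ᵇ 1) (T-∨ˡ _ (T-≡ᵇ (N ∸ 1)))

wheelAdj-sound : ∀ {N} (u w : Fin (suc N)) → T (wheelAdj N u w) → WheelEdge N (toℕ u) (toℕ w)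
wheelAdj-sound {N} u w t with toℕ u | toℕ w
... | a | b with T-∨⁻ ((a ≡ᵇ N) ∧ (b <ᵇ N)) t
...   | inj₁ p with T-∧⁻ (a ≡ᵇ N) p
...     | a≡N , b<N rewrite ℕₚ.≡ᵇ⇒≡ a N a≡N = spoke⁻¹ (ℕₚ.<ᵇ⇒< b N b<N)
wheelAdj-sound {N} u w t | a | b | inj₂ t′ with T-∨⁻ ((b ≡ᵇ N) ∧ (a <ᵇ N)) t′
...   | inj₁ p with T-∧⁻ (b ≡ᵇ N) p
...     | b≡N , a<N rewrite ℕₚ.≡ᵇ⇒≡ b N b≡N = spoke (ℕₚ.<ᵇ⇒< a N a<N)
wheelAdj-sound {N} u w t | a | b | inj₂ _ | inj₂ p with T-∧⁻ (a <ᵇ N) p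
...   | a<N , q with T-∧⁻ (b <ᵇ N) q
...     | b<N , c = rim-edge (ℕₚ.<ᵇ⇒< a N a<N) (ℕₚ.<ᵇ⇒< b N b<N) (cycleAdj-sound N a b c)

wheelAdj-complete : ∀ {N} (u w : Fin (suc N)) → WheelEdge N (toℕ u) (toℕ w) → T (wheelAdj N u w)
wheelAdj-complete {N} u w e with toℕ u | toℕ w
... | a | b with e
...   | spoke a<N = T-∨ʳ ((a ≡ᵇ N) ∧ (N <ᵇ N)) (T-∨ˡ _ (T-∧⁺ (T-≡ᵇ N) (ℕₚ.<⇒<ᵇ a<N)))
...   | spoke⁻¹ b<N = T-∨ˡ _ (T-∧⁺ (T-≡ᵇ N) (ℕₚ.<⇒<ᵇ b<N))
...   | rim-edge a<N b<N c =
  T-∨ʳ ((a ≡ᵇ N) ∧ (b <ᵇ N)) (T-∨ʳ ((b ≡ᵇ N) ∧ (a <ᵇ N))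
    (T-∧⁺ (ℕₚ.<⇒<ᵇ a<N) (T-∧⁺ (ℕₚ.<⇒<ᵇ b<N) (cycleAdj-complete c))))

Neighbours : ∀ {N} → Fin (suc N) → Fin (suc N) → Fin (suc N) → Fin (suc N) → Set
Neighbours {N} u a b c = ∀ w → T (wheelAdj N u w) ⇔ (w ≡ a ⊎ w ≡ b ⊎ w ≡ c)

outCurrent-neighbours : ∀ {N} φ {u a b c} → a ≢ b → a ≢ c → b ≢ c → Neighbours u a b c →
                        outCurrent N φ u ≡ (φ u - φ a) + ((φ u - φ b) + (φ u - φ c))
outCurrent-neighbours {N} φ {u} {a} {b} {c} a≢b a≢c b≢c nbrs = begin
  outCurrent N φ u         ≡⟨ sumFin≡sum (suc N) current ⟩
  sum current              ≡⟨ sum-supported₃ current a≢b a≢c b≢c vanish ⟩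
  current a + (current b + current c)
    ≡⟨ cong₂ _+_ (through a (inj₁ refl)) (cong₂ _+_ (through b (inj₂ (inj₁ refl))) (through c (inj₂ (inj₂ refl)))) ⟩
  (φ u - φ a) + ((φ u - φ b) + (φ u - φ c)) ∎
  where
  current : Fin (suc N) → ℚ
  current w = if wheelAdj N u w then φ u - φ w else 0ℚ
  through : ∀ w → w ≡ a ⊎ w ≡ b ⊎ w ≡ c → current w ≡ φ u - φ w
  through w p = if-true (Equivalence.from (nbrs w) p)
  vanish : ∀ w → w ≢ a → w ≢ b → w ≢ c → current w ≡ 0ℚ
  vanish w w≢a w≢b w≢c = if-false λ t → case (Equivalence.to (nbrs w) t)
    where
    case : w ≡ a ⊎ w ≡ b ⊎ w ≡ c → _
    case (inj₁ w≡a)        = w≢a w≡a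
    case (inj₂ (inj₁ w≡b)) = w≢b w≡b
    case (inj₂ (inj₂ w≡c)) = w≢c w≡c

3a-b-c-cong : ∀ {a b c a′ b′ c′} → a ≡ a′ → b ≡ b′ → c ≡ c′ → toℚ 3 * a - b - c ≡ toℚ 3 * a′ - b′ - c′
3a-b-c-cong refl refl refl = refl

current-in-offsets : ∀ h r a b → (r - h) + ((r - a) + (r - b)) ≡ toℚ 3 * (r - h) - (a - h) - (b - h)
current-in-offsets h r a b = solve (h ∷ r ∷ a ∷ b ∷ []) ℚ-ring

outCurrent-spokes : ∀ N φ → outCurrent N φ (hub N) ≡ ∑[ i < N ] (φ (hub N) - φ (inject₁ i))
outCurrent-spokes N φ = begin
  outCurrent N φ (hub N)                      ≡⟨ sumFin≡sum (suc N) current ⟩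
  sum current                                 ≡⟨ sum-init-last current ⟩
  sum (current ∘ inject₁) + current (hub N)   ≡⟨ cong₂ _+_ (sum-cong-≗ (if-true ∘ spoke-at)) (if-false no-loop) ⟩
  ∑[ i < N ] (φ (hub N) - φ (inject₁ i)) + 0ℚ ≡⟨ ℚₚ.+-identityʳ _ ⟩
  ∑[ i < N ] (φ (hub N) - φ (inject₁ i))      ∎
  where
  current : Fin (suc N) → ℚ
  current w = if wheelAdj N (hub N) w then φ (hub N) - φ w else 0ℚ
  spoke-at : ∀ i → T (wheelAdj N (hub N) (inject₁ i))
  spoke-at i = wheelAdj-complete (hub N) (inject₁ i)
    (subst₂ (WheelEdge N) (sym (Finₚ.toℕ-fromℕ N)) (sym (Finₚ.toℕ-inject₁ i)) (spoke⁻¹ (Finₚ.toℕ<n i)))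
  hub-edge-free : ¬ WheelEdge N N N
  hub-edge-free (spoke N<N)        = ℕₚ.n≮n N N<N
  hub-edge-free (spoke⁻¹ N<N)      = ℕₚ.n≮n N N<N
  hub-edge-free (rim-edge N<N _ _) = ℕₚ.n≮n N N<N
  no-loop : ¬ T (wheelAdj N (hub N) (hub N))
  no-loop t = hub-edge-free (subst₂ (WheelEdge N) (Finₚ.toℕ-fromℕ N) (Finₚ.toℕ-fromℕ N) (wheelAdj-sound _ _ t))

-- Kirchhoff's laws for a unit current from the hub to v₀, in terms of the
-- offsets x k = φ vₖ - φ hub of the rim vertices v₀ … vₘ (so N = 1 + m).
record WheelKirchhoff (m : ℕ) (x : ℕ → ℚ) : Set where
  field
    interior : ∀ j → j < m → ThreeTerm x j
    periodic : x (suc m) ≡ x 0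
    origin   : toℚ 3 * x 0 - x 1 - x m ≡ - 1ℚ
    central  : - ∑[ i < suc m ] x (toℕ i) ≡ 1ℚ

module Wheel (M : ℕ) where

  m N : ℕ
  m = 2 ℕ.+ M
  N = suc m

  rim : ℕ → Fin (suc N)
  rim k = inject₁ (k mod N)

  offset : (Fin (suc N) → ℚ) → ℕ → ℚ
  offset φ k = φ (rim k) - φ (hub N)

  toℕ-hub : toℕ (hub N) ≡ N
  toℕ-hub = Finₚ.toℕ-fromℕ N

  toℕ-rim : ∀ {k} → k < N → toℕ (rim k) ≡ k
  toℕ-rim {k} k<N = trans (Finₚ.toℕ-inject₁ (k mod N)) (trans (Finₚ.toℕ-fromℕ< _) (m<n⇒m%n≡m k<N))

  toℕ-rim< : ∀ k → toℕ (rim k) < N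
  toℕ-rim< k = subst (_< N) (sym (Finₚ.toℕ-inject₁ (k mod N))) (Finₚ.toℕ<n (k mod N))

  rim-periodic : rim N ≡ rim 0
  rim-periodic = cong inject₁ (Finₚ.toℕ-injective (trans (Finₚ.toℕ-fromℕ< _) (n%n≡0 N)))

  rim-toℕ : ∀ (i : Fin N) → rim (toℕ i) ≡ inject₁ i
  rim-toℕ i = Finₚ.toℕ-injective (trans (toℕ-rim (Finₚ.toℕ<n i)) (sym (Finₚ.toℕ-inject₁ i)))

  hub≢rim : ∀ k → hub N ≢ rim k
  hub≢rim k eq = ℕₚ.<-irrefl (trans (sym (cong toℕ eq)) toℕ-hub) (toℕ-rim< k)

  edge⇒adjacent : ∀ {u w a b} → toℕ u ≡ a → toℕ w ≡ b → WheelEdge N a b → T (wheelAdj N u w)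
  edge⇒adjacent {u} {w} refl refl = wheelAdj-complete u w

  vertex-cases : ∀ u → u ≡ hub N ⊎ u ≡ rim 0 ⊎ ∃[ j ] (j < m × u ≡ rim (suc j))
  vertex-cases u with ℕₚ.m<1+n⇒m<n∨m≡n (Finₚ.toℕ<n u)
  ... | inj₂ u≡N = inj₁ (Finₚ.toℕ-injective (trans u≡N (sym toℕ-hub)))
  ... | inj₁ u<N = inj₂ (on-rim (toℕ u) u<N (Finₚ.toℕ-injective (sym (toℕ-rim u<N))))
    where
    on-rim : ∀ k → k < N → u ≡ rim k → u ≡ rim 0 ⊎ ∃[ j ] (j < m × u ≡ rim (suc j))
    on-rim zero    _         eq = inj₁ eq
    on-rim (suc j) (s<s j<m) eq = inj₂ (j , j<m , eq)

  rim₀-edge : ∀ {b} → WheelEdge N 0 b → b ≡ N ⊎ b ≡ 1 ⊎ b ≡ m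
  rim₀-edge (spoke _)            = inj₁ refl
  rim₀-edge (rim-edge _ _ forward) = inj₂ (inj₁ refl)
  rim₀-edge (rim-edge _ _ wrap⁻¹)  = inj₂ (inj₂ refl)

  neighbours-rim₀ : Neighbours (rim 0) (hub N) (rim 1) (rim m)
  neighbours-rim₀ w = mk⇔ to from
    where
    to : T (wheelAdj N (rim 0) w) → w ≡ hub N ⊎ w ≡ rim 1 ⊎ w ≡ rim m
    to t with rim₀-edge (wheelAdj-sound (rim 0) w t)
    ... | inj₁ w≡N = inj₁ (Finₚ.toℕ-injective (trans w≡N (sym toℕ-hub)))
    ... | inj₂ (inj₁ w≡1) = inj₂ (inj₁ (Finₚ.toℕ-injective w≡1))
    ... | inj₂ (inj₂ w≡m) = inj₂ (inj₂ (Finₚ.toℕ-injective (trans w≡m (sym (toℕ-rim (ℕₚ.n<1+n m))))))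
    from : w ≡ hub N ⊎ w ≡ rim 1 ⊎ w ≡ rim m → T (wheelAdj N (rim 0) w)
    from (inj₁ refl)        = edge⇒adjacent refl toℕ-hub (spoke z<s)
    from (inj₂ (inj₁ refl)) = edge⇒adjacent refl refl (rim-edge z<s (s<s z<s) forward)
    from (inj₂ (inj₂ refl)) = edge⇒adjacent refl (toℕ-rim (ℕₚ.n<1+n m)) (rim-edge z<s (ℕₚ.n<1+n m) wrap⁻¹)

  rim-successor : ∀ {j} → j < m → (suc j < m × toℕ (rim (2 ℕ.+ j)) ≡ 2 ℕ.+ j) ⊎ (suc j ≡ m × toℕ (rim (2 ℕ.+ j)) ≡ 0)
  rim-successor j<m with ℕₚ.m<1+n⇒m<n∨m≡n j<m
  ... | inj₁ j<1+M = inj₁ (s<s j<1+M , toℕ-rim (s<s (s<s j<1+M)))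
  ... | inj₂ refl  = inj₂ (refl , cong toℕ rim-periodic)

  successor-edge : ∀ {j} → j < m → WheelEdge N (suc j) (toℕ (rim (2 ℕ.+ j)))
  successor-edge j<m with rim-successor j<m
  ... | inj₁ (1+j<m , e) = subst (WheelEdge N _) (sym e) (rim-edge (s<s j<m) (s<s 1+j<m) forward)
  ... | inj₂ (refl , e)  = subst (WheelEdge N _) (sym e) (rim-edge (s<s j<m) z<s wrap)

  rim≢successor : ∀ {j} → j < m → rim j ≢ rim (2 ℕ.+ j)
  rim≢successor {j} j<m eq with rim-successor j<m
  ... | inj₁ (_ , e)    = n≢2+n (trans (sym (toℕ-rim (ℕₚ.m<n⇒m<1+n j<m))) (trans (cong toℕ eq) e))
    where
    n≢2+n : ∀ {n} → n ≢ 2 ℕ.+ n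
    n≢2+n ()
  ... | inj₂ (refl , e) with trans (sym (toℕ-rim (ℕₚ.m<n⇒m<1+n j<m))) (trans (cong toℕ eq) e)
  ...   | ()

  rimSuc-edge : ∀ {j b} → j < m → WheelEdge N (suc j) b → b ≡ N ⊎ b ≡ j ⊎ b ≡ toℕ (rim (2 ℕ.+ j))
  rimSuc-edge _   (spoke _)                = inj₁ refl
  rimSuc-edge j<m (spoke⁻¹ _)              = ⊥-elim (ℕₚ.n≮n _ j<m)
  rimSuc-edge _   (rim-edge _ b<N forward) = inj₂ (inj₂ (sym (toℕ-rim b<N)))
  rimSuc-edge _   (rim-edge _ _ backward)  = inj₂ (inj₁ refl)
  rimSuc-edge _   (rim-edge _ _ wrap)      = inj₂ (inj₂ (sym (cong toℕ rim-periodic)))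

  neighbours-rimSuc : ∀ {j} → j < m → Neighbours (rim (suc j)) (hub N) (rim j) (rim (2 ℕ.+ j))
  neighbours-rimSuc {j} j<m w = mk⇔ to from
    where
    j<N : j < N
    j<N = ℕₚ.m<n⇒m<1+n j<m
    to : T (wheelAdj N (rim (suc j)) w) → w ≡ hub N ⊎ w ≡ rim j ⊎ w ≡ rim (2 ℕ.+ j)
    to t with rimSuc-edge j<m (subst (λ a → WheelEdge N a (toℕ w)) (toℕ-rim (s<s j<m)) (wheelAdj-sound _ w t))
    ... | inj₁ w≡N        = inj₁ (Finₚ.toℕ-injective (trans w≡N (sym toℕ-hub)))
    ... | inj₂ (inj₁ w≡j) = inj₂ (inj₁ (Finₚ.toℕ-injective (trans w≡j (sym (toℕ-rim j<N)))))
    ... | inj₂ (inj₂ w≡s) = inj₂ (inj₂ (Finₚ.toℕ-injective w≡s))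
    from : w ≡ hub N ⊎ w ≡ rim j ⊎ w ≡ rim (2 ℕ.+ j) → T (wheelAdj N (rim (suc j)) w)
    from (inj₁ refl)        = edge⇒adjacent (toℕ-rim (s<s j<m)) toℕ-hub (spoke (s<s j<m))
    from (inj₂ (inj₁ refl)) = edge⇒adjacent (toℕ-rim (s<s j<m)) (toℕ-rim j<N) (rim-edge (s<s j<m) j<N backward)
    from (inj₂ (inj₂ refl)) = edge⇒adjacent (toℕ-rim (s<s j<m)) refl (successor-edge j<m)

  outCurrent-rim₀ : ∀ φ → outCurrent N φ (rim 0) ≡ toℚ 3 * offset φ 0 - offset φ 1 - offset φ m
  outCurrent-rim₀ φ =
    trans (outCurrent-neighbours φ (hub≢rim 1) (hub≢rim m) rim₁≢rimₘ neighbours-rim₀)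
          (current-in-offsets (φ (hub N)) (φ (rim 0)) (φ (rim 1)) (φ (rim m)))
    where
    rim₁≢rimₘ : rim 1 ≢ rim m
    rim₁≢rimₘ eq with trans (cong toℕ eq) (toℕ-rim (ℕₚ.n<1+n m))
    ... | ()

  outCurrent-rimSuc : ∀ φ {j} → j < m →
                      outCurrent N φ (rim (suc j)) ≡ toℚ 3 * offset φ (suc j) - offset φ j - offset φ (2 ℕ.+ j)
  outCurrent-rimSuc φ {j} j<m =
    trans (outCurrent-neighbours φ (hub≢rim j) (hub≢rim (2 ℕ.+ j)) (rim≢successor j<m) (neighbours-rimSuc j<m))
          (current-in-offsets (φ (hub N)) (φ (rim (suc j))) (φ (rim j)) (φ (rim (2 ℕ.+ j))))

  outCurrent-hub : ∀ φ → outCurrent N φ (hub N) ≡ - ∑[ i < N ] offset φ (toℕ i)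
  outCurrent-hub φ = trans (outCurrent-spokes N φ) (trans (sum-cong-≗ spoke-current) (∑-neg N (offset φ ∘ toℕ)))
    where
    spoke-current : ∀ i → φ (hub N) - φ (inject₁ i) ≡ - offset φ (toℕ i)
    spoke-current i = trans (cong (λ v → φ (hub N) - φ v) (sym (rim-toℕ i))) (sym (neg-sub (φ (rim (toℕ i))) (φ (hub N))))

  injection-hub : injection N (hub N) ≡ 1ℚ
  injection-hub = if-true (ℕₚ.≡⇒≡ᵇ _ _ toℕ-hub)

  injection-rimSuc : ∀ {j} → j < m → injection N (rim (suc j)) ≡ 0ℚ
  injection-rimSuc j<m rewrite toℕ-rim (s<s j<m) = if-false (λ t → ℕₚ.<-irrefl (ℕₚ.≡ᵇ⇒≡ _ _ t) (s<s j<m))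

  flow⇒kirchhoff : ∀ φ → IsUnitFlowPotential N φ → WheelKirchhoff m (offset φ)
  flow⇒kirchhoff φ flow = record
    { interior = λ j j<m → trans (sym (outCurrent-rimSuc φ j<m)) (trans (flow (rim (suc j))) (injection-rimSuc j<m))
    ; periodic = cong (λ v → φ v - φ (hub N)) rim-periodic
    ; origin   = trans (sym (outCurrent-rim₀ φ)) (flow (rim 0))
    ; central  = trans (sym (outCurrent-hub φ)) (trans (flow (hub N)) injection-hub)
    }

  potential : (ℕ → ℚ) → Fin (suc N) → ℚ
  potential x w = if toℕ w <ᵇ N then x (toℕ w) else 0ℚ

  potential-rim : ∀ x {k} → k < N → potential x (rim k) ≡ x k
  potential-rim x k<N rewrite toℕ-rim k<N = if-true (ℕₚ.<⇒<ᵇ k<N)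

  potential-hub : ∀ x → potential x (hub N) ≡ 0ℚ
  potential-hub x = if-false (λ t → ℕₚ.<-irrefl toℕ-hub (ℕₚ.<ᵇ⇒< _ _ t))

  offset-potential< : ∀ x {k} → k < N → offset (potential x) k ≡ x k
  offset-potential< x {k} k<N = trans (cong₂ _-_ (potential-rim x k<N) (potential-hub x)) (ℚₚ.+-identityʳ (x k))

  offset-potential : ∀ x → x (suc m) ≡ x 0 → ∀ k → k ≤ N → offset (potential x) k ≡ x k
  offset-potential x periodic k k≤N with ℕₚ.m≤n⇒m<n∨m≡n k≤N
  ... | inj₁ k<N = offset-potential< x k<N
  ... | inj₂ refl = begin
    offset (potential x) N  ≡⟨ cong (λ v → potential x v - potential x (hub N)) rim-periodic ⟩
    offset (potential x) 0  ≡⟨ offset-potential< x z<s ⟩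
    x 0                     ≡⟨ periodic ⟨
    x N                     ∎

  module _ {x} (K : WheelKirchhoff m x) where
    open WheelKirchhoff K

    private
      φ = potential x
      offset≡x = offset-potential x periodic

    kirchhoff⇒flow : IsUnitFlowPotential N (potential x)
    kirchhoff⇒flow u with vertex-cases u
    ... | inj₁ refl = begin
      outCurrent N φ (hub N)         ≡⟨ outCurrent-hub φ ⟩
      - ∑[ i < N ] offset φ (toℕ i)  ≡⟨ cong -_ (sum-cong-≗ (λ i → offset≡x (toℕ i) (ℕₚ.<⇒≤ (Finₚ.toℕ<n i)))) ⟩
      - ∑[ i < N ] x (toℕ i)         ≡⟨ central ⟩
      1ℚ                             ≡⟨ injection-hub ⟨
      injection N (hub N)            ∎
    ... | inj₂ (inj₁ refl) = begin
      outCurrent N φ (rim 0)                              ≡⟨ outCurrent-rim₀ φ ⟩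
      toℚ 3 * offset φ 0 - offset φ 1 - offset φ m        ≡⟨ 3a-b-c-cong (offset≡x 0 z≤n) (offset≡x 1 (s≤s z≤n)) (offset≡x m (ℕₚ.n≤1+n m)) ⟩
      toℚ 3 * x 0 - x 1 - x m                             ≡⟨ origin ⟩
      injection N (rim 0)                                 ∎
    ... | inj₂ (inj₂ (j , j<m , refl)) = begin
      outCurrent N φ (rim (suc j))                                      ≡⟨ outCurrent-rimSuc φ j<m ⟩
      toℚ 3 * offset φ (suc j) - offset φ j - offset φ (2 ℕ.+ j)        ≡⟨ 3a-b-c-cong (offset≡x (suc j) (ℕₚ.<⇒≤ (s<s j<m)))
                                                                                       (offset≡x j (ℕₚ.<⇒≤ (ℕₚ.m<n⇒m<1+n j<m)))
                                                                                       (offset≡x (2 ℕ.+ j) (s≤s j<m)) ⟩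
      toℚ 3 * x (suc j) - x j - x (2 ℕ.+ j)                             ≡⟨ interior j j<m ⟩
      0ℚ                                                                ≡⟨ injection-rimSuc j<m ⟨
      injection N (rim (suc j))                                         ∎

-- The effective resistance

module Resistance {G : ℕ → ℕ} (fib : FibLike G) (M : ℕ) (reflectable : Reflectable G (3 ℕ.+ M))
                  .{{_ : NonZero (G (2 ℕ.+ M) ℕ.+ G (4 ℕ.+ M))}} where

  open Wheel M

  D : ℕ
  D = G (N ∸ 1) ℕ.+ G (suc N)

  Y : ℕ → ℚ
  Y i = toℚ (G ∣ N - i ℕ.* 2 ∣)

  Y-threeTerm : ∀ j → ThreeTerm Y j
  Y-threeTerm j = threeTerm-intro Y j (begin
    Y j + Y (2 ℕ.+ j)                                             ≡⟨ toℚ-+ (G ∣ N - j ℕ.* 2 ∣) (G ∣ N - (2 ℕ.+ j) ℕ.* 2 ∣) ⟨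
    toℚ (G ∣ N - j ℕ.* 2 ∣ ℕ.+ G ∣ N - (2 ℕ.+ j) ℕ.* 2 ∣)          ≡⟨ cong toℚ (folded-bisection fib N j reflectable) ⟩
    toℚ (3 ℕ.* G ∣ N - (1 ℕ.+ j) ℕ.* 2 ∣)                          ≡⟨ toℚ-* 3 (G ∣ N - (1 ℕ.+ j) ℕ.* 2 ∣) ⟩
    toℚ 3 * Y (suc j)                                             ∎)

  Y-periodic : Y (suc m) ≡ Y 0
  Y-periodic = cong (toℚ ∘ G) (trans (cong (λ k → ∣ N - k ∣) (double N)) (ℕₚ.∣m-m+n∣≡n N N))
    where
    double : ∀ n → n ℕ.* 2 ≡ n ℕ.+ n
    double = ℕ-Solver.solve-∀

  Y-last : Y m ≡ Y 1
  Y-last = cong (toℚ ∘ G) (trans (cong (λ k → ∣ N - k ∣) (split M)) (ℕₚ.∣m-m+n∣≡n N (1 ℕ.+ M)))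
    where
    split : ∀ n → (2 ℕ.+ n) ℕ.* 2 ≡ (3 ℕ.+ n) ℕ.+ (1 ℕ.+ n)
    split = ℕ-Solver.solve-∀

  denominator : toℚ 3 * Y 0 - Y 1 - Y m ≡ toℚ D
  denominator = begin
    toℚ 3 * Y 0 - Y 1 - Y m             ≡⟨ cong (λ t → toℚ 3 * Y 0 - Y 1 - t) Y-last ⟩
    toℚ 3 * Y 0 - Y 1 - Y 1             ≡⟨ cong (λ t → t - Y 1 - Y 1) three-Y₀ ⟩
    (toℚ D + (Y 1 + Y 1)) - Y 1 - Y 1   ≡⟨ cancel (toℚ D) (Y 1) ⟩
    toℚ D                               ∎
    where
    fib-identity : D ℕ.+ (G (1 ℕ.+ M) ℕ.+ G (1 ℕ.+ M)) ≡ 3 ℕ.* G N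
    fib-identity rewrite fib (2 ℕ.+ M) | fib (1 ℕ.+ M) = regroup (G (2 ℕ.+ M)) (G (1 ℕ.+ M))
      where
      regroup : ∀ a b → (a ℕ.+ ((a ℕ.+ b) ℕ.+ a)) ℕ.+ (b ℕ.+ b) ≡ 3 ℕ.* (a ℕ.+ b)
      regroup = ℕ-Solver.solve-∀
    three-Y₀ : toℚ 3 * Y 0 ≡ toℚ D + (Y 1 + Y 1)
    three-Y₀ = begin
      toℚ 3 * Y 0                                ≡⟨ toℚ-* 3 (G N) ⟨
      toℚ (3 ℕ.* G N)                            ≡⟨ cong toℚ fib-identity ⟨
      toℚ (D ℕ.+ (G (1 ℕ.+ M) ℕ.+ G (1 ℕ.+ M)))  ≡⟨ toℚ-+ D _ ⟩
      toℚ D + toℚ (G (1 ℕ.+ M) ℕ.+ G (1 ℕ.+ M))  ≡⟨ cong (toℚ D +_) (toℚ-+ (G (1 ℕ.+ M)) (G (1 ℕ.+ M))) ⟩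
      toℚ D + (Y 1 + Y 1)                        ∎
    cancel : ∀ d b → (d + (b + b)) - b - b ≡ d
    cancel d b = solve (d ∷ b ∷ []) ℚ-ring

  scale : ℚ
  scale = - (1/ toℚ D)

  scale*D≡-1 : scale * toℚ D ≡ - 1ℚ
  scale*D≡-1 = trans (sym (ℚₚ.neg-distribˡ-* (1/ toℚ D) (toℚ D))) (cong -_ (ℚₚ.*-inverseˡ (toℚ D)))

  solution : WheelKirchhoff m (λ k → scale * Y k)
  solution = record
    { interior = λ j _ → threeTerm-scale scale {Y} j (Y-threeTerm j)
    ; periodic = cong (scale *_) Y-periodic
    ; origin   = begin
        toℚ 3 * (scale * Y 0) - scale * Y 1 - scale * Y m  ≡⟨ 3a-b-c-scale scale (Y 1) (Y 0) (Y m) ⟩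
        scale * (toℚ 3 * Y 0 - Y 1 - Y m)                  ≡⟨ cong (scale *_) denominator ⟩
        scale * toℚ D                                      ≡⟨ scale*D≡-1 ⟩
        - 1ℚ                                               ∎
    ; central  = begin
        - ∑[ i < suc m ] (scale * Y (toℕ i))  ≡⟨ cong -_ (*-distribˡ-sum {suc m} scale (Y ∘ toℕ)) ⟨
        - (scale * ∑[ i < suc m ] Y (toℕ i))  ≡⟨ cong (λ t → - (scale * t)) ∑Y≡D ⟩
        - (scale * toℚ D)                     ≡⟨ cong -_ scale*D≡-1 ⟩
        - - 1ℚ                                ≡⟨ neg-involutive 1ℚ ⟩
        1ℚ                                    ∎
    }
    where
    ∑Y≡D : ∑[ i < suc m ] Y (toℕ i) ≡ toℚ D
    ∑Y≡D = trans (∑-threeTerm m Y (λ j _ → Y-threeTerm j) Y-periodic) denominator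

  unique : ∀ φ → IsUnitFlowPotential N φ → φ (fromℕ N) - φ zero ≡ ℤ.+ G N / D
  unique φ flow = *-toℚ⇒≡/ (G N) D (begin
    (φ (hub N) - φ (rim 0)) * toℚ D        ≡⟨ cong (_* toℚ D) (neg-sub (φ (rim 0)) (φ (hub N))) ⟨
    - offset φ 0 * toℚ D                   ≡⟨ ℚₚ.neg-distribˡ-* (offset φ 0) (toℚ D) ⟨
    - (offset φ 0 * toℚ D)                 ≡⟨ cong (λ t → - (offset φ 0 * t)) denominator ⟨
    - (offset φ 0 * (toℚ 3 * Y 0 - Y 1 - Y m))
      ≡⟨ cong -_ (value-at-origin m Y (offset φ) (λ j _ → Y-threeTerm j) interior Y-periodic periodic origin) ⟩
    - - Y 0                                 ≡⟨ neg-involutive (Y 0) ⟩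
    toℚ (G N)                               ∎)
    where
    open WheelKirchhoff (flow⇒kirchhoff φ flow)

  resistance : Σ (Fin (suc N) → ℚ) (IsUnitFlowPotential N)
             × ((φ : Fin (suc N) → ℚ) → IsUnitFlowPotential N φ → φ (fromℕ N) - φ zero ≡ ℤ.+ G N / D)
  resistance = (potential (λ k → scale * Y k) , kirchhoff⇒flow solution) , unique

parity : ∀ n → (n % 2 ≡ 1 × Reflectable F n) ⊎ (n % 2 ≡ 0 × Reflectable L n)
parity zero          = inj₂ (refl , refl)
parity (suc zero)    = inj₁ (refl , refl)
parity (suc (suc n)) = parity n

lemma4 : (N : ℕ) → 3 ≤ N →
    Σ (Fin (Data.Nat.suc N) → ℚ) (λ φ → IsUnitFlowPotential N φ)
    × ((φ : Fin (Data.Nat.suc N) → ℚ) → IsUnitFlowPotential N φ →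
         φ (fromℕ N) - φ zero ≡ wheelResistance N)
lemma4 (suc (suc (suc M))) (s≤s (s≤s (s≤s _))) with parity (3 ℕ.+ M)
... | inj₁ (odd , reflectable)  rewrite odd  =
  Resistance.resistance (λ _ → refl) M reflectable {{F-den-nz (3 ℕ.+ M)}}
... | inj₂ (even , reflectable) rewrite even =
  Resistance.resistance (λ _ → refl) M reflectable {{L-den-nz (3 ℕ.+ M)}}
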